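{- For every $m\in\mathbb{N}$ there exists a natural number $C'=C'(m)$ such that for every colouring $\Delta:\mathbb{N}_1\times\mathbb{N}_2\rightarrow\mathbb{N}$ of the edges of the complete bipartite graph between two copies $\mathbb{N}_1,\mathbb{N}_2$ of $\mathbb{N}$ that uses at least $C'$ distinct colours, there exist $X\subset\mathbb{N}_1$ and $Y\subset\mathbb{N}_2$ such that the edges of the complete bipartite graph between $X$ and $Y$ use exactly $m$ distinct colours, i.e. $|\Delta(X\times Y)|=m$. -}

module Defs where

open import Level using (0ℓ)
open import Data.Nat using (ℕ; _≤_)
open import Data.List using (List; length)
open import Data.List.Relation.Unary.Unique.Propositional using (Unique)
open import Data.List.Membership.Propositional using (_∈_)
open import Data.Product using (Σ; ∃; ∃-syntax; _×_)
open import Relation.Binary.PropositionalEquality using (_≡_)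
open import Relation.Unary using (Pred)

Colouring : Set
Colouring = ℕ → ℕ → ℕ

UsedOn : Colouring → Pred ℕ 0ℓ → Pred ℕ 0ℓ → ℕ → Set
UsedOn Δ X Y c = ∃[ x ] ∃[ y ] (X x × Y y × Δ x y ≡ c)

UsesAtLeast : Colouring → ℕ → Set
UsesAtLeast Δ C =
  Σ (List ℕ) λ cs → C ≤ length cs × Unique cs × (∀ c → c ∈ cs → ∃[ x ] ∃[ y ] (Δ x y ≡ c))

-- |Δ(X × Y)| = m : the image of X × Y under Δ is exactly the set of
-- elements of a duplicate-free list of length m.
ImageSize : Colouring → Pred ℕ 0ℓ → Pred ℕ 0ℓ → ℕ → Set
ImageSize Δ X Y m =
  Σ (List ℕ) λ cs → length cs ≡ m × Unique cs
    × (∀ c → c ∈ cs → UsedOn Δ X Y c)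
    × (∀ x y → X x → Y y → Δ x y ∈ cs)

-- Choose edges p₁, …, p_N of pairwise distinct colours and look at the grid spanned by their
-- endpoints.  If one row x of the grid shows m colours, then X = {x} and Y = {y | Δ x y is one
-- of m chosen colours} work, and columns are symmetric.  Otherwise every row and column of the
-- grid shows fewer than m colours, and a greedy Ramsey-type construction applies: keep the first
-- point, discard the fewer than 2m points whose colour occurs in its row or column, and
-- pigeonhole on the colours its row and its column take on the rest.  Iterating, and
-- pigeonholing once more, gives a staircase q₀, …, q_k with Δ(xᵢ, yⱼ) = a and Δ(xⱼ, yᵢ) = b for
-- i < j, whose diagonal colours Δ(xᵢ, yᵢ) are distinct and differ from a and b.  For w < v < T
-- in a staircase (T ≠ ∅) the rectangle ({w} ∪ T) × ({v} ∪ T) uses exactly the colours a, b and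
-- Δ(x_t, y_t) for t ∈ T, i.e. |T| + |{a, b}| of them, which can be made equal to m.

module Submission where

open import Level using (0ℓ)
open import Function using (_∘_; flip; id)
open import Data.Empty using (⊥)
open import Data.Nat using (ℕ; zero; suc; _+_; _*_; _≤_; _<_; _≤?_; _≟_; z≤n; s≤s; z<s; >-nonZero)
open import Data.Nat.Properties
open import Data.Product using (Σ; ∃-syntax; _×_; _,_; proj₁; proj₂)
open import Data.Sum using (_⊎_; inj₁; inj₂)
open import Data.List using (List; []; _∷_; _++_; length; map; filter; take; deduplicate)
open import Data.List.Properties using (length-map; length-take; length-++)
open import Data.List.Relation.Unary.All as All using (All; []; _∷_)
import Data.List.Relation.Unary.All.Properties as AllP
open import Data.List.Relation.Unary.Any as Any using (Any; here; there; any?)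
open import Data.List.Relation.Unary.AllPairs as AllPairs using (AllPairs; []; _∷_)
import Data.List.Relation.Unary.AllPairs.Properties as AllPairsP
open import Data.List.Relation.Unary.Unique.Propositional using (Unique)
import Data.List.Relation.Unary.Unique.Propositional.Properties as UniqueP
open import Data.List.Relation.Unary.Unique.DecPropositional.Properties _≟_ using (deduplicate-!)
open import Data.List.Membership.Propositional using (_∈_; _∉_)
open import Data.List.Membership.Propositional.Properties
  using (∈-map⁺; ∈-map⁻; ∈-filter⁻; ∈-++⁺ˡ; ∈-++⁺ʳ; ∈-deduplicate⁺; ∈-deduplicate⁻)
open import Data.List.Membership.DecPropositional _≟_ using (_∈?_)
open import Data.List.Relation.Binary.Subset.Propositional using (_⊆_)
import Data.List.Relation.Binary.Sublist.Propositional as Sublist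
import Data.List.Relation.Binary.Sublist.Propositional.Properties as SublistP
open import Relation.Nullary using (¬_; yes; no; ¬?; contradiction)
open import Relation.Unary using (Pred; Decidable)
open import Relation.Binary.PropositionalEquality
open import Defs

module _ {A : Set} where

  length-filter-∁ : {P : Pred A 0ℓ} (P? : Decidable P) (xs : List A) →
                    length xs ≡ length (filter P? xs) + length (filter (¬? ∘ P?) xs)
  length-filter-∁ P? []       = refl
  length-filter-∁ P? (x ∷ xs) with P? x
  ... | yes _ = cong suc (length-filter-∁ P? xs)
  ... | no  _ = trans (cong suc (length-filter-∁ P? xs)) (sym (+-suc _ _))

  fibre : (A → ℕ) → ℕ → List A → List A
  fibre f v = filter (λ p → f p ≟ v)

  pigeonhole : (f : A → ℕ) (V : List ℕ) (P : List A) → (∀ {p} → p ∈ P → f p ∈ V) →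
               ∃[ v ] length P ≤ length V * length (fibre f v P)
  pigeonhole f []      []      _    = 0 , z≤n
  pigeonhole f []      (p ∷ P) into with () ← into (here refl)
  pigeonhole f (v ∷ V) P       into = larger (≤-total (count w) (count v))
    where
    P′ : List A
    P′ = filter (λ p → ¬? (f p ≟ v)) P

    into′ : ∀ {p} → p ∈ P′ → f p ∈ V
    into′ p∈P′ with ∈-filter⁻ (λ p → ¬? (f p ≟ v)) p∈P′
    ... | p∈P , fp≢v with into p∈P
    ...   | here fp≡v  = contradiction fp≡v fp≢v
    ...   | there fp∈V = fp∈V

    count : ℕ → ℕ
    count u = length (fibre f u P)

    rec : ∃[ w ] length P′ ≤ length V * length (fibre f w P′)
    rec = pigeonhole f V P′ into′

    w : ℕ
    w = proj₁ rec

    bound : length P ≤ count v + length V * count w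
    bound = begin
      length P                                   ≡⟨ length-filter-∁ (λ p → f p ≟ v) P ⟩
      count v + length P′                        ≤⟨ +-monoʳ-≤ (count v) (proj₂ rec) ⟩
      count v + length V * length (fibre f w P′) ≤⟨ +-monoʳ-≤ (count v) (*-monoʳ-≤ (length V) shrink) ⟩
      count v + length V * count w               ∎
      where
      open ≤-Reasoning
      shrink : length (fibre f w P′) ≤ count w
      shrink = SublistP.length-mono-≤ (SublistP.filter⁺ (λ p → f p ≟ w) (λ p → f p ≟ w)
                 (λ { refl fp≡w → fp≡w }) (SublistP.filter-⊆ (λ p → ¬? (f p ≟ v)) P))

    larger : count w ≤ count v ⊎ count v ≤ count w → ∃[ u ] length P ≤ length (v ∷ V) * count u
    larger (inj₁ w≤v) = v , ≤-trans bound (+-monoʳ-≤ (count v) (*-monoʳ-≤ (length V) w≤v))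
    larger (inj₂ v≤w) = w , ≤-trans bound (+-monoˡ-≤ (length V * count w) v≤w)

  pigeonhole-< : ∀ {m k} (f : A → ℕ) (V : List ℕ) (P : List A) → (∀ {p} → p ∈ P → f p ∈ V) →
                 length V < m → m * k ≤ length P → ∃[ v ] k ≤ length (fibre f v P)
  pigeonhole-< {m} f V P into V<m mk≤P with pigeonhole f V P into
  ... | v , bound = v , *-cancelˡ-≤ m {{>-nonZero (<-≤-trans z<s V<m)}}
                          (≤-trans mk≤P (≤-trans bound (*-monoˡ-≤ _ (<⇒≤ V<m))))

unique-constant⇒length≤1 : ∀ {v : ℕ} {xs} → Unique xs → All (_≡ v) xs → length xs ≤ 1
unique-constant⇒length≤1 {xs = []}        _               _               = z≤n
unique-constant⇒length≤1 {xs = _ ∷ []}    _               _               = s≤s z≤n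
unique-constant⇒length≤1 {xs = _ ∷ _ ∷ _} ((x≢y ∷ _) ∷ _) (x≡v ∷ y≡v ∷ _) =
  contradiction (trans x≡v (sym y≡v)) x≢y

unique-⊆⇒length≤ : ∀ {xs ys : List ℕ} → Unique xs → xs ⊆ ys → length xs ≤ length ys
unique-⊆⇒length≤ {xs} {ys} unique xs⊆ys with pigeonhole id ys xs xs⊆ys
... | v , bound = begin
  length xs                                ≤⟨ bound ⟩
  length ys * length (filter (_≟ v) xs)    ≤⟨ *-monoʳ-≤ (length ys) at-most-once ⟩
  length ys * 1                            ≡⟨ *-identityʳ (length ys) ⟩
  length ys                                ∎
  where
  open ≤-Reasoning
  at-most-once : length (filter (_≟ v) xs) ≤ 1
  at-most-once = unique-constant⇒length≤1 (AllPairsP.filter⁺ (_≟ v) unique) (AllP.all-filter (_≟ v) xs)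

length-filter-∉ : ∀ {A : Set} (f : A → ℕ) (W : List ℕ) (xs : List A) →
                  AllPairs (λ p q → f p ≢ f q) xs →
                  length xs ≤ length W + length (filter (λ p → ¬? (f p ∈? W)) xs)
length-filter-∉ f W xs distinct = begin
  length xs                                                 ≡⟨ length-filter-∁ (λ p → f p ∈? W) xs ⟩
  length hits + length (filter (λ p → ¬? (f p ∈? W)) xs)   ≤⟨ +-monoˡ-≤ _ hits≤W ⟩
  length W + length (filter (λ p → ¬? (f p ∈? W)) xs)      ∎
  where
  open ≤-Reasoning
  hits = filter (λ p → f p ∈? W) xs

  hit-values⊆W : map f hits ⊆ W
  hit-values⊆W c∈ with ∈-map⁻ f c∈
  ... | p , p∈hits , refl = proj₂ (∈-filter⁻ (λ p → f p ∈? W) {xs = xs} p∈hits)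

  hits≤W : length hits ≤ length W
  hits≤W = ≤-trans (≤-reflexive (sym (length-map f hits)))
    (unique-⊆⇒length≤ (AllPairsP.map⁺ (AllPairsP.filter⁺ (λ p → f p ∈? W) distinct)) hit-values⊆W)

pair-trichotomy : ∀ {A : Set} {R : A → A → Set} {xs : List A} {x y} →
                  AllPairs R xs → x ∈ xs → y ∈ xs → x ≡ y ⊎ R x y ⊎ R y x
pair-trichotomy (_   ∷ _)  (here refl) (here refl) = inj₁ refl
pair-trichotomy (Rx ∷ _)   (here refl) (there y∈)  = inj₂ (inj₁ (All.lookup Rx y∈))
pair-trichotomy (Ry ∷ _)   (there x∈)  (here refl) = inj₂ (inj₂ (All.lookup Ry x∈))
pair-trichotomy (_   ∷ Rs) (there x∈)  (there y∈)  = pair-trichotomy Rs x∈ y∈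

prefix-length : ∀ {A : Set} {m} (xs : List A) → m ≤ length xs → length (take m xs) ≡ m
prefix-length {m = m} xs m≤xs = trans (length-take m xs) (m≤n⇒m⊓n≡m m≤xs)

ExactRectangle : Colouring → ℕ → Set₁
ExactRectangle Δ m = Σ (Pred ℕ 0ℓ) λ X → Σ (Pred ℕ 0ℓ) λ Y → ImageSize Δ X Y m

empty-rectangle : ∀ Δ → ExactRectangle Δ 0
empty-rectangle Δ = (λ _ → ⊥) , (λ _ → ⊥) , [] , refl , [] , (λ _ ()) , λ _ _ ()

transpose : ∀ {Δ X Y m} → ImageSize (flip Δ) Y X m → ImageSize Δ X Y m
transpose {Δ} {X} {Y} (cs , size , unique , used , covered) =
  cs , size , unique , (λ c c∈cs → swap (used c c∈cs)) , λ x y x∈X y∈Y → covered y x y∈Y x∈X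
  where
  swap : ∀ {c} → UsedOn (flip Δ) Y X c → UsedOn Δ X Y c
  swap (y , x , y∈Y , x∈X , e) = x , y , x∈X , y∈Y , e

row-image : (Δ : Colouring) (x : ℕ) (D : List ℕ) → Unique D → (∀ {c} → c ∈ D → ∃[ y ] Δ x y ≡ c) →
            ImageSize Δ (_≡ x) (λ y → Δ x y ∈ D) (length D)
row-image Δ x D unique in-row = D , refl , unique , used , λ { _ _ refl y∈Y → y∈Y }
  where
  used : ∀ c → c ∈ D → UsedOn Δ (_≡ x) (λ y → Δ x y ∈ D) c
  used c c∈D with in-row c∈D
  ... | y , refl = x , y , refl , c∈D , refl

palette : Colouring → ℕ → List ℕ → List ℕ
palette Δ x ys = deduplicate _≟_ (map (Δ x) ys)

∈-palette : ∀ Δ x {ys y} → y ∈ ys → Δ x y ∈ palette Δ x ys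
∈-palette _ _ y∈ys = ∈-deduplicate⁺ _≟_ (∈-map⁺ _ y∈ys)

wide-row : ∀ Δ x ys {m} → m ≤ length (palette Δ x ys) → ExactRectangle Δ m
wide-row Δ x ys {m} wide =
  _ , _ , subst (ImageSize Δ _ _) (prefix-length (palette Δ x ys) wide)
            (row-image Δ x (take m (palette Δ x ys)) (UniqueP.take⁺ m (deduplicate-! _)) in-row)
  where
  in-row : ∀ {c} → c ∈ take m (palette Δ x ys) → ∃[ y ] Δ x y ≡ c
  in-row c∈ with ∈-map⁻ (Δ x) (∈-deduplicate⁻ _≟_ _ (Sublist.lookup (SublistP.take-⊆ m _) c∈))
  ... | y , _ , refl = y , refl

wide-column : ∀ Δ y xs {m} → m ≤ length (palette (flip Δ) y xs) → ExactRectangle Δ m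
wide-column Δ y xs wide with wide-row (flip Δ) y xs wide
... | Y , X , image = X , Y , transpose image

-- After two final pigeonhole steps 2 + m rungs share their colours; dropping the first leaves a
-- staircase of m + 1 points.
rungsNeeded : ℕ → ℕ
rungsNeeded m = m * (m * (2 + m))

-- Each rung uses up one point, discards fewer than m + m points and keeps a 1/m fraction of the
-- rest in each of two pigeonhole steps.
towerSize : ℕ → ℕ → ℕ
towerSize m zero    = 1
towerSize m (suc n) = suc (m + m + m * (m * towerSize m n))

module _ (Δ : Colouring) where

  Point : Set
  Point = ℕ × ℕ

  colour : Point → ℕ
  colour (x , y) = Δ x y

  Rainbow : List Point → Set
  Rainbow = AllPairs (λ p q → colour p ≢ colour q)

  Ascending : ℕ → ℕ → Point → Point → Set
  Ascending a b (x , y) (x′ , y′) = Δ x y′ ≡ a × Δ x′ y ≡ b × Δ x y ≢ Δ x′ y′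

  Staircase : ℕ → ℕ → List Point → Set
  Staircase a b ps = AllPairs (Ascending a b) ps × All (λ p → colour p ≢ a × colour p ≢ b) ps

  staircase-take : ∀ {a b ps} n → Staircase a b ps → Staircase a b (take n ps)
  staircase-take n (ascending , avoiding) = AllPairsP.take⁺ n ascending , AllP.take⁺ n avoiding

  staircase-edge : ∀ {a b T p q} → AllPairs (Ascending a b) T → p ∈ T → q ∈ T →
                   Δ (proj₁ p) (proj₂ q) ∈ a ∷ b ∷ map colour T
  staircase-edge ascending p∈T q∈T with pair-trichotomy ascending p∈T q∈T
  ... | inj₁ refl                 = there (there (∈-map⁺ colour p∈T))
  ... | inj₂ (inj₁ (p↗q , _))     = here p↗q
  ... | inj₂ (inj₂ (_ , q↘p , _)) = there (here q↘p)

  staircase-colours-unique : ∀ {a b T} → AllPairs (Ascending a b) T → Unique (map colour T)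
  staircase-colours-unique ascending = AllPairsP.map⁺ (AllPairs.map (proj₂ ∘ proj₂) ascending)

  colours-avoid : ∀ {c T} → All (λ p → colour p ≢ c) T → All (c ≢_) (map colour T)
  colours-avoid avoiding = AllP.map⁺ (All.map (λ p≢c c≡p → p≢c (sym c≡p)) avoiding)

  staircase-rectangle : ∀ {a b w v t T m} (cs : List ℕ) → Staircase a b (w ∷ v ∷ T) → t ∈ T →
                        a ∷ b ∷ map colour T ⊆ cs → cs ⊆ a ∷ b ∷ map colour T →
                        Unique cs → length cs ≡ m → ExactRectangle Δ m
  staircase-rectangle {a} {b} {w} {v} {t} {T} cs ((w↗ ∷ v↗ ∷ T↗) , _) t∈T ⊆cs cs⊆ unique size =
    X , Y , cs , size , unique , used , covered
    where
    X Y : Pred ℕ 0ℓ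
    X = _∈ map proj₁ (w ∷ T)
    Y = _∈ map proj₂ (v ∷ T)

    in-X : ∀ {p} → p ∈ w ∷ T → X (proj₁ p)
    in-X = ∈-map⁺ proj₁

    in-Y : ∀ {q} → q ∈ v ∷ T → Y (proj₂ q)
    in-Y = ∈-map⁺ proj₂

    edge : ∀ {p q} → p ∈ w ∷ T → q ∈ v ∷ T → Δ (proj₁ p) (proj₂ q) ∈ a ∷ b ∷ map colour T
    edge (here refl) (here refl) = here (proj₁ (All.head w↗))
    edge (here refl) (there q∈T) = here (proj₁ (All.lookup w↗ (there q∈T)))
    edge (there p∈T) (here refl) = there (here (proj₁ (proj₂ (All.lookup v↗ p∈T))))
    edge (there p∈T) (there q∈T) = staircase-edge T↗ p∈T q∈T

    covered : ∀ x y → X x → Y y → Δ x y ∈ cs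
    covered _ _ x∈X y∈Y with ∈-map⁻ proj₁ x∈X | ∈-map⁻ proj₂ y∈Y
    ... | p , p∈ , refl | q , q∈ , refl = ⊆cs (edge p∈ q∈)

    used : ∀ c → c ∈ cs → UsedOn Δ X Y c
    used c c∈cs with cs⊆ c∈cs
    ... | here refl = proj₁ w , proj₂ v , in-X (here refl) , in-Y (here refl) , proj₁ (All.head w↗)
    ... | there (here refl) =
      proj₁ t , proj₂ v , in-X (there t∈T) , in-Y (here refl) , proj₁ (proj₂ (All.lookup v↗ t∈T))
    ... | there (there c∈T) with ∈-map⁻ colour c∈T
    ...   | s , s∈T , refl = proj₁ s , proj₂ s , in-X (there s∈T) , in-Y (there s∈T) , refl

  rectangle-equal-colours : ∀ {a w v t T} → Staircase a a (w ∷ v ∷ T) → t ∈ T →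
                            ExactRectangle Δ (suc (length T))
  rectangle-equal-colours {a} {T = T} st@((_ ∷ _ ∷ T↗) , (_ ∷ _ ∷ avoiding)) t∈T =
    staircase-rectangle (a ∷ map colour T) st t∈T
      (λ { (here refl) → here refl ; (there (here refl)) → here refl ; (there (there c∈T)) → there c∈T })
      (λ { (here refl) → here refl ; (there c∈T) → there (there c∈T) })
      (colours-avoid (All.map proj₁ avoiding) ∷ staircase-colours-unique T↗)
      (cong suc (length-map colour T))

  rectangle-distinct-colours : ∀ {a b w v t T} → a ≢ b → Staircase a b (w ∷ v ∷ T) → t ∈ T →
                               ExactRectangle Δ (suc (suc (length T)))
  rectangle-distinct-colours {a} {b} {T = T} a≢b st@((_ ∷ _ ∷ T↗) , (_ ∷ _ ∷ avoiding)) t∈T =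
    staircase-rectangle (a ∷ b ∷ map colour T) st t∈T (λ c∈ → c∈) (λ c∈ → c∈)
      ((a≢b ∷ colours-avoid (All.map proj₁ avoiding)) ∷ colours-avoid (All.map proj₂ avoiding) ∷
        staircase-colours-unique T↗)
      (cong (suc ∘ suc) (length-map colour T))

  staircase-image : ∀ {a b} m (ps : List Point) → Staircase a b ps → suc m ≤ length ps → ExactRectangle Δ m
  staircase-image zero _ _ _ = empty-rectangle Δ
  -- The smallest counts come from the row of the first point, which shows its own colour and a.
  staircase-image 1 (w ∷ _) _ _ =
    _ , _ , row-image Δ (proj₁ w) (colour w ∷ []) ([] ∷ []) λ { (here refl) → proj₂ w , refl }
  staircase-image {a} 2 (w ∷ v ∷ _) ((w↗ ∷ _) , ((w≢a , _) ∷ _)) _ =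
    _ , _ , row-image Δ (proj₁ w) (colour w ∷ a ∷ []) ((w≢a ∷ []) ∷ [] ∷ [])
              λ { (here refl) → proj₂ w , refl ; (there (here refl)) → proj₂ v , proj₁ (All.head w↗) }
  staircase-image 2 (_ ∷ []) _ (s≤s ())
  staircase-image {a} {b} (suc (suc (suc j))) (w ∷ v ∷ r ∷ rest) st (s≤s (s≤s (s≤s long))) with a ≟ b
  ... | yes refl = subst (ExactRectangle Δ) (cong (suc ∘ suc) (prefix-length rest long))
                     (rectangle-equal-colours (staircase-take (4 + j) st) (here refl))
  ... | no a≢b   = subst (ExactRectangle Δ)
                     (cong (suc ∘ suc ∘ suc) (prefix-length rest (≤-trans (n≤1+n j) long)))
                     (rectangle-distinct-colours a≢b (staircase-take (3 + j) st) (here refl))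

  record Rung : Set where
    constructor rung
    field
      point               : Point
      rowColour colColour : ℕ

  open Rung

  Dominates : Rung → Point → Set
  Dominates (rung (x , y) a b) (x′ , y′) =
    Δ x y′ ≡ a × Δ x′ y ≡ b × Δ x′ y′ ≢ Δ x y × Δ x′ y′ ≢ a × Δ x′ y′ ≢ b

  Nested : Rung → Rung → Set
  Nested s t = Dominates s (point t)

  record Tower (n : ℕ) (pool : List Point) : Set where
    field
      rungs         : List Rung
      apex          : Point
      height        : length rungs ≡ n
      nested        : AllPairs Nested rungs
      dominate-apex : All (λ t → Dominates t apex) rungs
      rungs-in-pool : All (λ t → point t ∈ pool) rungs
      apex-in-pool  : apex ∈ pool

  tower-apex : ∀ {p pool} → p ∈ pool → Tower 0 pool
  tower-apex {p} p∈pool = record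
    { rungs = [] ; apex = p ; height = refl ; nested = [] ; dominate-apex = []
    ; rungs-in-pool = [] ; apex-in-pool = p∈pool }

  tower-cons : ∀ {n pool pool′} (t : Rung) → pool′ ⊆ pool → (∀ {q} → q ∈ pool′ → Dominates t q) →
               Tower n pool′ → Tower (suc n) (point t ∷ pool)
  tower-cons t pool′⊆pool dominated T = record
    { rungs         = t ∷ rungs
    ; apex          = apex
    ; height        = cong suc height
    ; nested        = All.map dominated rungs-in-pool ∷ nested
    ; dominate-apex = dominated apex-in-pool ∷ dominate-apex
    ; rungs-in-pool = here refl ∷ All.map (there ∘ pool′⊆pool) rungs-in-pool
    ; apex-in-pool  = there (pool′⊆pool apex-in-pool) }
    where open Tower T

  -- The first rung is dropped: its own colour may be a or b, but every later point avoids both.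
  staircase-of-rungs : ∀ {a b h Q} → All ((_≡ a) ∘ rowColour) (h ∷ Q) →
                       All ((_≡ b) ∘ colColour) (h ∷ Q) →
                       AllPairs Nested (h ∷ Q) → Staircase a b (map point Q)
  staircase-of-rungs {a} {b} (h≡a ∷ rows) (h≡b ∷ columns) (h↗ ∷ nested) =
    ascending rows columns nested , AllP.map⁺ (All.map avoiding h↗)
    where
    avoiding : ∀ {q} → Dominates _ q → colour q ≢ a × colour q ≢ b
    avoiding (_ , _ , _ , q≢h-row , q≢h-column) =
      (λ q≡a → q≢h-row (trans q≡a (sym h≡a))) , (λ q≡b → q≢h-column (trans q≡b (sym h≡b)))

    ascending : ∀ {Q} → All ((_≡ a) ∘ rowColour) Q → All ((_≡ b) ∘ colColour) Q →
                AllPairs Nested Q → AllPairs (Ascending a b) (map point Q)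
    ascending [] [] [] = []
    ascending (t≡a ∷ rows) (t≡b ∷ columns) (t↗ ∷ nested) =
      AllP.map⁺ (All.map (λ (row , column , distinct , _) →
                            trans row t≡a , trans column t≡b , distinct ∘ sym) t↗)
        ∷ ascending rows columns nested

  module SparseGrid (m : ℕ) (ps : List Point)
    (narrow-rows    : ∀ {p} → p ∈ ps → length (palette Δ (proj₁ p) (map proj₂ ps)) < m)
    (narrow-columns : ∀ {p} → p ∈ ps → length (palette (flip Δ) (proj₂ p) (map proj₁ ps)) < m)
    where

    rowPalette colPalette : Point → List ℕ
    rowPalette p = palette Δ (proj₁ p) (map proj₂ ps)
    colPalette p = palette (flip Δ) (proj₂ p) (map proj₁ ps)

    ∈-rowPalette : ∀ p {q} → q ∈ ps → Δ (proj₁ p) (proj₂ q) ∈ rowPalette p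
    ∈-rowPalette p q∈ps = ∈-palette Δ (proj₁ p) (∈-map⁺ proj₂ q∈ps)

    ∈-colPalette : ∀ p {q} → q ∈ ps → Δ (proj₁ q) (proj₂ p) ∈ colPalette p
    ∈-colPalette p q∈ps = ∈-palette (flip Δ) (proj₂ p) (∈-map⁺ proj₁ q∈ps)

    record Refinement (k : ℕ) (p : Point) (rest : List Point) : Set where
      field
        a b       : ℕ
        pool      : List Point
        pool⊆rest : pool ⊆ rest
        rainbow   : Rainbow pool
        size      : k ≤ length pool
        dominated : ∀ {q} → q ∈ pool → Dominates (rung p a b) q

    refine : ∀ {k p} → p ∈ ps → (rest : List Point) → rest ⊆ ps → Rainbow rest →
             m + m + m * (m * k) ≤ length rest → Refinement k p rest
    refine {k} {p} p∈ps rest rest⊆ps rainbow long = record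
      { a = a ; b = b ; pool = pool₂ ; pool⊆rest = proj₁ ∘ from-pool₂
      ; rainbow = AllPairsP.filter⁺ _ (AllPairsP.filter⁺ _ (AllPairsP.filter⁺ _ rainbow))
      ; size = proj₂ second ; dominated = dominated }
      where
      R S : List ℕ
      R = rowPalette p
      S = colPalette p

      in-row in-column : Point → ℕ
      in-row q    = Δ (proj₁ p) (proj₂ q)
      in-column q = Δ (proj₁ q) (proj₂ p)

      fresh : List Point
      fresh = filter (λ q → ¬? (colour q ∈? R ++ S)) rest

      palettes-small : length (R ++ S) ≤ m + m
      palettes-small = ≤-trans (≤-reflexive (length-++ R))
                         (+-mono-≤ (<⇒≤ (narrow-rows p∈ps)) (<⇒≤ (narrow-columns p∈ps)))

      fresh-size : m * (m * k) ≤ length fresh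
      fresh-size = +-cancelˡ-≤ (m + m) _ _ (begin
        m + m + m * (m * k)            ≤⟨ long ⟩
        length rest                    ≤⟨ length-filter-∉ colour (R ++ S) rest rainbow ⟩
        length (R ++ S) + length fresh ≤⟨ +-monoˡ-≤ (length fresh) palettes-small ⟩
        m + m + length fresh           ∎)
        where open ≤-Reasoning

      fresh⊆rest : fresh ⊆ rest
      fresh⊆rest q∈ = proj₁ (∈-filter⁻ _ {xs = rest} q∈)

      first : ∃[ a ] m * k ≤ length (fibre in-row a fresh)
      first = pigeonhole-< in-row R fresh (λ q∈ → ∈-rowPalette p (rest⊆ps (fresh⊆rest q∈)))
                (narrow-rows p∈ps) fresh-size

      a : ℕ
      a = proj₁ first

      pool₁ : List Point
      pool₁ = fibre in-row a fresh

      pool₁⊆fresh : pool₁ ⊆ fresh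
      pool₁⊆fresh q∈ = proj₁ (∈-filter⁻ _ {xs = fresh} q∈)

      second : ∃[ b ] k ≤ length (fibre in-column b pool₁)
      second = pigeonhole-< in-column S pool₁
                 (λ q∈ → ∈-colPalette p (rest⊆ps (fresh⊆rest (pool₁⊆fresh q∈))))
                 (narrow-columns p∈ps) (proj₂ first)

      b : ℕ
      b = proj₁ second

      pool₂ : List Point
      pool₂ = fibre in-column b pool₁

      from-pool₂ : ∀ {q} → q ∈ pool₂ → q ∈ rest × colour q ∉ R ++ S × in-row q ≡ a × in-column q ≡ b
      from-pool₂ q∈₂ with ∈-filter⁻ _ {xs = pool₁} q∈₂
      ... | q∈₁ , column≡b with ∈-filter⁻ _ {xs = fresh} q∈₁
      ... | q∈fresh , row≡a with ∈-filter⁻ _ {xs = rest} q∈fresh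
      ... | q∈rest , fresh-q = q∈rest , fresh-q , row≡a , column≡b

      dominated : ∀ {q} → q ∈ pool₂ → Dominates (rung p a b) q
      dominated q∈₂ with from-pool₂ q∈₂
      ... | q∈rest , fresh-q , row≡a , column≡b =
        row≡a , column≡b , outside-R (∈-rowPalette p p∈ps) ,
        outside-R (subst (_∈ R) row≡a (∈-rowPalette p (rest⊆ps q∈rest))) ,
        outside-S (subst (_∈ S) column≡b (∈-colPalette p (rest⊆ps q∈rest)))
        where
        outside-R : ∀ {c} → c ∈ R → colour _ ≢ c
        outside-R c∈R refl = fresh-q (∈-++⁺ˡ c∈R)
        outside-S : ∀ {c} → c ∈ S → colour _ ≢ c
        outside-S c∈S refl = fresh-q (∈-++⁺ʳ R c∈S)

    tower : ∀ n (pool : List Point) → pool ⊆ ps → Rainbow pool → towerSize m n ≤ length pool →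
            Tower n pool
    tower zero    (p ∷ _)    _       _             _          = tower-apex (here refl)
    tower (suc n) (p ∷ rest) pool⊆ps (_ ∷ rest-rainbow) (s≤s long) =
      tower-cons (rung p a b) pool⊆rest dominated
        (tower n pool (λ q∈ → pool⊆ps (there (pool⊆rest q∈))) rainbow size)
      where
      open Refinement (refine (pool⊆ps (here refl)) rest (λ q∈ → pool⊆ps (there q∈)) rest-rainbow long)

    rectangle-from-tower : Tower (rungsNeeded m) ps → ExactRectangle Δ m
    rectangle-from-tower T = rungs-rectangle Q₂
      (AllP.filter⁺ _ (AllP.all-filter _ rungs)) (AllP.all-filter _ Q₁)
      (AllPairsP.filter⁺ _ (AllPairsP.filter⁺ _ nested)) (proj₂ second)
      where
      open Tower T

      -- The rung colours occur in the apex's column and row, so fewer than m values are possible.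
      into-colPalette : ∀ {t} → t ∈ rungs → rowColour t ∈ colPalette apex
      into-colPalette t∈ = subst (_∈ colPalette apex) (proj₁ (All.lookup dominate-apex t∈))
                             (∈-colPalette apex (All.lookup rungs-in-pool t∈))

      first : ∃[ a ] m * (2 + m) ≤ length (fibre rowColour a rungs)
      first = pigeonhole-< rowColour (colPalette apex) rungs into-colPalette
                (narrow-columns apex-in-pool) (≤-reflexive (sym height))

      a : ℕ
      a = proj₁ first

      Q₁ : List Rung
      Q₁ = fibre rowColour a rungs

      into-rowPalette : ∀ {t} → t ∈ Q₁ → colColour t ∈ rowPalette apex
      into-rowPalette t∈ with ∈-filter⁻ _ {xs = rungs} t∈
      ... | t∈rungs , _ = subst (_∈ rowPalette apex) (proj₁ (proj₂ (All.lookup dominate-apex t∈rungs)))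
                             (∈-rowPalette apex (All.lookup rungs-in-pool t∈rungs))

      second : ∃[ b ] 2 + m ≤ length (fibre colColour b Q₁)
      second = pigeonhole-< colColour (rowPalette apex) Q₁ into-rowPalette
                 (narrow-rows apex-in-pool) (proj₂ first)

      b : ℕ
      b = proj₁ second

      Q₂ : List Rung
      Q₂ = fibre colColour b Q₁

      rungs-rectangle : ∀ Q → All ((_≡ a) ∘ rowColour) Q → All ((_≡ b) ∘ colColour) Q →
                        AllPairs Nested Q → 2 + m ≤ length Q → ExactRectangle Δ m
      rungs-rectangle (h ∷ Q) rows columns nested (s≤s long) =
        staircase-image m (map point Q) (staircase-of-rungs rows columns nested)
          (≤-trans long (≤-reflexive (sym (length-map point Q))))

  realise : (cs : List ℕ) → (∀ c → c ∈ cs → ∃[ x ] ∃[ y ] Δ x y ≡ c) →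
            Σ (List Point) λ ps → map colour ps ≡ cs
  realise []       _        = [] , refl
  realise (c ∷ cs) in-image
    with in-image c (here refl) | realise cs (λ c′ c′∈ → in-image c′ (there c′∈))
  ... | x , y , xy≡c | ps , ps≡cs = (x , y) ∷ ps , cong₂ _∷_ xy≡c ps≡cs

  narrow : ∀ {m} {xs : List Point} (L : Point → ℕ) → ¬ Any (λ p → m ≤ L p) xs →
           ∀ {p} → p ∈ xs → L p < m
  narrow L no-wide p∈xs = ≰⇒> (All.lookup (AllP.¬Any⇒All¬ _ no-wide) p∈xs)

  grid-rectangle : ∀ m (ps : List Point) → Rainbow ps → towerSize m (rungsNeeded m) ≤ length ps →
                   ExactRectangle Δ m
  grid-rectangle m ps rainbow large
    with any? (λ p → m ≤? length (palette Δ (proj₁ p) (map proj₂ ps))) ps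
       | any? (λ p → m ≤? length (palette (flip Δ) (proj₂ p) (map proj₁ ps))) ps
  ... | yes wide-somewhere | _ with (p , wide) ← Any.satisfied wide-somewhere =
    wide-row Δ (proj₁ p) (map proj₂ ps) wide
  ... | no _ | yes wide-somewhere with (p , wide) ← Any.satisfied wide-somewhere =
    wide-column Δ (proj₂ p) (map proj₁ ps) wide
  ... | no narrow-rows | no narrow-columns =
    rectangle-from-tower (tower (rungsNeeded m) ps (λ p∈ → p∈) rainbow large)
    where open SparseGrid m ps (narrow _ narrow-rows) (narrow _ narrow-columns)

  exact-rectangle : ∀ m → UsesAtLeast Δ (towerSize m (rungsNeeded m)) → ExactRectangle Δ m
  exact-rectangle m (cs , many , unique , in-image) with realise cs in-image
  ... | ps , ps≡cs = grid-rectangle m ps (AllPairsP.map⁻ (subst Unique (sym ps≡cs) unique))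
                       (≤-trans many (≤-reflexive (trans (cong length (sym ps≡cs)) (length-map colour ps))))

theorem5 : (m : ℕ) → ∃[ C′ ] ((Δ : Colouring) → UsesAtLeast Δ C′ →
             Σ (Pred ℕ 0ℓ) λ X → Σ (Pred ℕ 0ℓ) λ Y → ImageSize Δ X Y m)
theorem5 m = towerSize m (rungsNeeded m) , λ Δ → exact-rectangle Δ m
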